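{- Let $A$ be a $\mathbb{Z}$-torsion-free $\mathbb{Z}_{(p)}$-algebra and $\mathfrak{a}\subseteq A$ a divided-power ideal, and let $P, Q$ be monic polynomials in $A[X]$. Then the following are equivalent: (1) $e_n(P) \equiv e_n(Q) \pmod{\mathfrak{a}}$ for every $n \geq 1$; (2) $e_n(P) \equiv e_n(Q) \pmod{\mathfrak{a}}$ for every $n$ with $1 \leq n \leq \max\{\deg P, \deg Q\}$; (3) $p_n(P) \equiv p_n(Q) \pmod{n\mathfrak{a}}$ for every $n \geq 1$; (4) $p_n(P) \equiv p_n(Q) \pmod{n\mathfrak{a}}$ for every $n$ with $1 \leq n \leq \max\{\deg P, \deg Q\}$.
   Context: $p$ is a prime and $\mathbb{Z}_{(p)}\subseteq\mathbb{Q}$ is the ring of rationals with denominator prime to $p$. An ideal $\mathfrak{a}$ of $A$ is a divided-power ideal if for every $a\in\mathfrak{a}$ and every $k\geq 1$ we have $a^k/k!\in\mathfrak{a}$ (computed in $A\otimes\mathbb{Q}$), i.e. $a^k \in k!\,\mathfrak{a}$. For a monic $Q = X^d + a_1X^{d-1}+\cdots+a_d\in A[X]$: $e_0(Q)=1$, $e_n(Q) = (-1)^n a_n$ for $1\le n\le d$, $e_n(Q)=0$ for $n>d$. For a symmetric function $f$ with integer coefficients (in infinitely many variables), $f(Q)$ is obtained by writing $f$ as an integer polynomial in the elementary symmetric functions $e_1,e_2,\dots$ and substituting $e_n(Q)$ for $e_n$; $p_n(Q)$ for $n\ge1$ is this applied to the power-sum symmetric function $p_n=\sum_i x_i^n$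 (when $A$ is a domain, $p_n(Q)$ is the sum of the $n$-th powers of the roots of $Q$ counted with multiplicity). -}

module Defs where

open import Level using (Level; _⊔_)
open import Algebra.Bundles using (CommutativeRing)
open import Data.Nat as ℕ using (ℕ; zero; suc; _≤_)
open import Data.Nat using (_!)
open import Data.Nat.Divisibility using (_∣_)
open import Data.Vec using (Vec; lookup)
open import Data.Fin using (fromℕ<)
open import Data.List using (List; []; _∷_)
open import Data.Product using (Σ; _×_)
open import Relation.Nullary using (¬_)

module RingDefs {c ℓ : Level} (R : CommutativeRing c ℓ) where
  open CommutativeRing R

  _·_ : ℕ → Carrier → Carrier
  zero · x = 0#
  suc n · x = x + (n · x)

  pow : Carrier → ℕ → Carrier
  pow x zero = 1#
  pow x (suc n) = x * pow x n

  sgn : ℕ → Carrier → Carrier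
  sgn zero x = x
  sgn (suc n) x = - sgn n x

  TorsionFree : Set (c ⊔ ℓ)
  TorsionFree = ∀ (n : ℕ) (x : Carrier) → 1 ≤ n → (n · x) ≈ 0# → x ≈ 0#

  ZpAlgebra : ℕ → Set (c ⊔ ℓ)
  ZpAlgebra p = ∀ (m : ℕ) → ¬ (p ∣ m) → Σ Carrier (λ y → ((m · 1#) * y) ≈ 1#)

  record IsIdeal {ℓ' : Level} (I : Carrier → Set ℓ') : Set (c ⊔ ℓ ⊔ ℓ') where
    field
      resp  : ∀ {x y} → x ≈ y → I x → I y
      zero∈ : I 0#
      +-closed : ∀ {x y} → I x → I y → I (x + y)
      *-closed : ∀ (r : Carrier) {x} → I x → I (r * x)

  IsDividedPower : {ℓ' : Level} → (Carrier → Set ℓ') → Set (c ⊔ ℓ ⊔ ℓ')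
  IsDividedPower I = ∀ (a : Carrier) → I a → ∀ (k : ℕ) → 1 ≤ k →
                     Σ Carrier (λ b → I b × (pow a k ≈ ((k !) · b)))

  CongMod : {ℓ' : Level} → (Carrier → Set ℓ') → Carrier → Carrier → Set ℓ'
  CongMod I x y = I (x - y)

  CongModMul : {ℓ' : Level} → (Carrier → Set ℓ') → ℕ → Carrier → Carrier → Set (c ⊔ ℓ ⊔ ℓ')
  CongModMul I n x y = Σ Carrier (λ b → I b × ((x - y) ≈ (n · b)))

  -- A monic polynomial Q = X^d + a₁X^{d-1} + ⋯ + a_d of degree d is represented
  -- by d together with the vector (a₁, …, a_d).
  -- e_n(Q): e₀ = 1, e_n = (-1)^n a_n for 1 ≤ n ≤ d, e_n = 0 for n > d.
  e : ∀ {d} → Vec Carrier d → ℕ → Carrier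
  e {d} v zero = 1#
  e {d} v (suc n) with suc n ℕ.≤? d
  ... | Relation.Nullary.yes le = sgn (suc n) (lookup v (fromℕ< le))
  ... | Relation.Nullary.no _ = 0#

  -- Power sums p_n as the integer polynomial in e₁, e₂, … given by Newton's identities:
  --   p_m = Σ_{i=1}^{m-1} (-1)^{i-1} e_i p_{m-i} + (-1)^{m-1} m e_m.
  module Newton (E : ℕ → Carrier) where
    go : ℕ → List Carrier → Carrier
    go i [] = 0#
    go i (q ∷ qs) = sgn (ℕ.pred i) (E i * q) + go (suc i) qs

    -- ps n = [p_n, p_{n-1}, …, p_1]
    ps : ℕ → List Carrier
    ps zero = []
    ps (suc n) = (go 1 (ps n) + sgn n ((suc n) · E (suc n))) ∷ ps n

    pn : ℕ → Carrier
    pn n with ps n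
    ... | [] = 0#
    ... | x ∷ _ = x

  p : ∀ {d} → Vec Carrier d → ℕ → Carrier
  p v = Newton.pn (e v)

{-# OPTIONS --safe #-}
-- Put F = Σ (-1)ⁿ eₙ tⁿ, which is ∏ (1 - xᵢ t) over the roots, and q = Σ p_{n+1} tⁿ.
-- Newton's identities say q F = -F′, so q is minus the logarithmic derivative of F. Suppose
-- q and q′ are congruent modulo (m+1)𝔞 for m < N, say q_m - q′_m = (m+1) c_m. Multiply F by
-- G = ∏_{m<N} exp(c_m t^{m+1}). Divided powers make G a series congruent to 1 modulo 𝔞, and
-- the logarithmic derivative of F G agrees with that of F′ below degree N. Since A is
-- torsion-free, F G and F′ then agree up to degree N, so F ≡ F G ≡ F′ modulo 𝔞 in these
-- degrees. Conversely, if moreover F ≡ F′ in degree N+1, comparing the next coefficient gives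
-- q_N - q′_N = (N+1)(F′_{N+1} - (F G)_{N+1}) ∈ (N+1)𝔞, and one inducts on N. Bounding n by the
-- degree only matters for the eₙ, which vanish beyond it.
module Submission where

open import Defs
open import Level using (Level)
open import Algebra.Bundles using (CommutativeRing)
open import Data.Nat as ℕ using (ℕ; zero; suc; _≤_; _<_; _⊔_; s≤s; z≤n; _!)
open import Data.Nat.Primality using (Prime)
open import Data.Vec using (Vec)
open import Data.Product using (_×_; _,_; proj₁; proj₂)
import Data.Nat.Properties as ℕP
open import Data.Nat.DivMod using (_%_; _/_; m≡m%n+[m/n]*n; m<n⇒m%n≡m; [m+n]%n≡m%n; +-distrib-/-∣ˡ; n/n≡1)
open import Data.Nat.Divisibility using (∣-refl)
open import Data.Integer as ℤ using (ℤ; +_; -[1+_]; _⊖_; _◃_)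
import Data.Integer.Properties as ℤP
open import Data.Sign as Sign using (Sign)
open import Data.Maybe using (Maybe; just; nothing)
open import Data.Sum using (inj₁; inj₂)
open import Function using (_∘_)
open import Relation.Nullary using (contradiction; yes; no)
open import Relation.Binary.PropositionalEquality as ≡ using (_≡_; _≢_)

module IntegerCoefficients {c ℓ : Level} (R : CommutativeRing c ℓ) where
  open CommutativeRing R
  open RingDefs R using (_·_)
  import Algebra.Properties.Semiring.Mult.TCOptimised semiring as Mult
  open import Algebra.Properties.Ring ring using (-‿involutive; -‿distribˡ-*; -‿distribʳ-*; -0#≈0#; -‿+-comm)
  open import Algebra.Properties.AbelianGroup +-abelianGroup using (xyx⁻¹≈y)
  open import Algebra.Solver.Ring.AlmostCommutativeRing using (_-Raw-AlmostCommutative⟶_; fromCommutativeRing)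
  open import Relation.Binary.Reasoning.Setoid setoid

  -- The optimised multiple makes ι 1 definitionally 1#, which the solver's constants rely on.
  ι : ℕ → Carrier
  ι n = n Mult.× 1#

  ι-suc : ∀ n → ι (suc n) ≈ 1# + ι n
  ι-suc n = Mult.1+× n 1#

  ι-+ : ∀ m n → ι (m ℕ.+ n) ≈ ι m + ι n
  ι-+ = Mult.×-homo-+ 1#

  ι-* : ∀ m n → ι (m ℕ.* n) ≈ ι m * ι n
  ι-* = Mult.×1-homo-*

  ·≈ι* : ∀ n x → n · x ≈ ι n * x
  ·≈ι* zero x = sym (zeroˡ x)
  ·≈ι* (suc n) x = begin
    x + n · x          ≈⟨ +-cong (sym (*-identityˡ x)) (·≈ι* n x) ⟩
    1# * x + ι n * x   ≈⟨ distribʳ x 1# (ι n) ⟨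
    (1# + ι n) * x     ≈⟨ *-congʳ (ι-suc n) ⟨
    ι (suc n) * x      ∎

  signed : Sign → Carrier → Carrier
  signed Sign.+ x = x
  signed Sign.- x = - x

  signed-cong : ∀ s {x y} → x ≈ y → signed s x ≈ signed s y
  signed-cong Sign.+ x≈y = x≈y
  signed-cong Sign.- x≈y = -‿cong x≈y

  signed-* : ∀ s t x y → signed (s Sign.* t) (x * y) ≈ signed s x * signed t y
  signed-* Sign.+ Sign.+ x y = refl
  signed-* Sign.+ Sign.- x y = -‿distribʳ-* x y
  signed-* Sign.- Sign.+ x y = -‿distribˡ-* x y
  signed-* Sign.- Sign.- x y = trans (sym (-‿involutive _)) (trans (-‿cong (-‿distribˡ-* x y)) (-‿distribʳ-* _ y))

  [a+x]-[a+y]≈x-y : ∀ a x y → (a + x) - (a + y) ≈ x - y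
  [a+x]-[a+y]≈x-y a x y = begin
    (a + x) - (a + y)     ≈⟨ +-congˡ (-‿+-comm a y) ⟨
    (a + x) + (- a - y)   ≈⟨ +-assoc (a + x) (- a) (- y) ⟨
    (a + x - a) - y       ≈⟨ +-congʳ (xyx⁻¹≈y a x) ⟩
    x - y                 ∎

  ιℤ : ℤ → Carrier
  ιℤ (+ n) = ι n
  ιℤ -[1+ n ] = - ι (suc n)

  ιℤ-◃ : ∀ s n → ιℤ (s ◃ n) ≈ signed s (ι n)
  ιℤ-◃ Sign.+ zero = refl
  ιℤ-◃ Sign.- zero = sym -0#≈0#
  ιℤ-◃ Sign.+ (suc n) = refl
  ιℤ-◃ Sign.- (suc n) = refl

  ιℤ-sign-abs : ∀ i → signed (ℤ.sign i) (ι ℤ.∣ i ∣) ≈ ιℤ i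
  ιℤ-sign-abs (+ n) = refl
  ιℤ-sign-abs -[1+ n ] = refl

  ιℤ-⊖ : ∀ m n → ιℤ (m ⊖ n) ≈ ι m - ι n
  ιℤ-⊖ m zero = sym (trans (+-congˡ -0#≈0#) (+-identityʳ _))
  ιℤ-⊖ zero (suc n) = sym (+-identityˡ _)
  ιℤ-⊖ (suc m) (suc n) = begin
    ιℤ (suc m ⊖ suc n)        ≡⟨ ≡.cong ιℤ (ℤP.[1+m]⊖[1+n]≡m⊖n m n) ⟩
    ιℤ (m ⊖ n)                ≈⟨ ιℤ-⊖ m n ⟩
    ι m - ι n                 ≈⟨ [a+x]-[a+y]≈x-y 1# (ι m) (ι n) ⟨
    (1# + ι m) - (1# + ι n)   ≈⟨ +-cong (ι-suc m) (-‿cong (ι-suc n)) ⟨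
    ι (suc m) - ι (suc n)     ∎

  ιℤ-+ : ∀ i j → ιℤ (i ℤ.+ j) ≈ ιℤ i + ιℤ j
  ιℤ-+ (+ m) (+ n) = ι-+ m n
  ιℤ-+ (+ m) -[1+ n ] = ιℤ-⊖ m (suc n)
  ιℤ-+ -[1+ m ] (+ n) = trans (ιℤ-⊖ n (suc m)) (+-comm _ _)
  ιℤ-+ -[1+ m ] -[1+ n ] = begin
    - ι (suc (suc (m ℕ.+ n)))  ≡⟨ ≡.cong (λ k → - ι (suc k)) (ℕP.+-suc m n) ⟨
    - ι (suc m ℕ.+ suc n)      ≈⟨ -‿cong (ι-+ (suc m) (suc n)) ⟩
    - (ι (suc m) + ι (suc n))  ≈⟨ -‿+-comm _ _ ⟨
    - ι (suc m) - ι (suc n)    ∎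

  ιℤ-* : ∀ i j → ιℤ (i ℤ.* j) ≈ ιℤ i * ιℤ j
  ιℤ-* i j = begin
    ιℤ (s Sign.* t ◃ ∣i∣ ℕ.* ∣j∣)               ≈⟨ ιℤ-◃ (s Sign.* t) (∣i∣ ℕ.* ∣j∣) ⟩
    signed (s Sign.* t) (ι (∣i∣ ℕ.* ∣j∣))       ≈⟨ signed-cong (s Sign.* t) (ι-* ∣i∣ ∣j∣) ⟩
    signed (s Sign.* t) (ι ∣i∣ * ι ∣j∣)         ≈⟨ signed-* s t (ι ∣i∣) (ι ∣j∣) ⟩
    signed s (ι ∣i∣) * signed t (ι ∣j∣)         ≈⟨ *-cong (ιℤ-sign-abs i) (ιℤ-sign-abs j) ⟩
    ιℤ i * ιℤ j                                 ∎
    where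
    s = ℤ.sign i
    t = ℤ.sign j
    ∣i∣ = ℤ.∣ i ∣
    ∣j∣ = ℤ.∣ j ∣

  ιℤ-morphism : ℤ.+-*-rawRing -Raw-AlmostCommutative⟶ fromCommutativeRing R
  ιℤ-morphism = record
    { ⟦_⟧ = ιℤ ; +-homo = ιℤ-+ ; *-homo = ιℤ-* ; -‿homo = ιℤ-neg ; 0-homo = refl ; 1-homo = refl }
    where
    ιℤ-neg : ∀ i → ιℤ (ℤ.- i) ≈ - ιℤ i
    ιℤ-neg (+ zero) = sym -0#≈0#
    ιℤ-neg (+ suc n) = refl
    ιℤ-neg -[1+ n ] = sym (-‿involutive _)

  ιℤ-≟ : ∀ i j → Maybe (ιℤ i ≈ ιℤ j)
  ιℤ-≟ i j with i ℤ.≟ j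
  ... | yes ≡.refl = just refl
  ... | no _ = nothing

  open import Algebra.Solver.Ring ℤ.+-*-rawRing (fromCommutativeRing R) ιℤ-morphism ιℤ-≟ public
    using (solve; _:=_; _:+_; _:*_; :-_; _:-_; con)

module PowerSeries {c ℓ : Level} (R : CommutativeRing c ℓ) where
  open CommutativeRing R
  open IntegerCoefficients R
  open import Algebra.Properties.Ring ring using (-‿distribˡ-*; -‿distribʳ-*; -‿+-comm; -0#≈0#)
  open import Algebra.Properties.CommutativeSemigroup +-commutativeSemigroup using () renaming (interchange to +-interchange)
  open import Relation.Binary.Reasoning.Setoid setoid

  Series : Set c
  Series = ℕ → Carrier

  infix 4 _≋_
  _≋_ : Series → Series → Set ℓ
  F ≋ G = ∀ n → F n ≈ G n

  infixl 6 _⊕_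
  _⊕_ : Series → Series → Series
  (F ⊕ G) n = F n + G n

  ⊝_ : Series → Series
  (⊝ F) n = - F n

  tail : Series → Series
  tail F n = F (suc n)

  shift : Series → Series
  shift F zero = 0#
  shift F (suc n) = F n

  infixl 7 _⋆_
  _⋆_ : Series → Series → Series
  (F ⋆ G) zero = F 0 * G 0
  (F ⋆ G) (suc n) = F 0 * G (suc n) + (tail F ⋆ G) n

  D : Series → Series
  D F n = ι n * F n

  ⋆-cong≤ : ∀ n {F F′ G G′} → (∀ i → i ≤ n → F i ≈ F′ i) → (∀ i → i ≤ n → G i ≈ G′ i) →
            (F ⋆ G) n ≈ (F′ ⋆ G′) n
  ⋆-cong≤ zero F≈F′ G≈G′ = *-cong (F≈F′ 0 z≤n) (G≈G′ 0 z≤n)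
  ⋆-cong≤ (suc n) F≈F′ G≈G′ = +-cong (*-cong (F≈F′ 0 z≤n) (G≈G′ (suc n) ℕP.≤-refl))
    (⋆-cong≤ n (λ i i≤n → F≈F′ (suc i) (s≤s i≤n)) (λ i i≤n → G≈G′ i (ℕP.m≤n⇒m≤1+n i≤n)))

  ⋆-cong : ∀ {F F′ G G′} → F ≋ F′ → G ≋ G′ → F ⋆ G ≋ F′ ⋆ G′
  ⋆-cong F≋F′ G≋G′ n = ⋆-cong≤ n (λ i _ → F≋F′ i) (λ i _ → G≋G′ i)

  ⋆-zeroˡ : ∀ G → (λ _ → 0#) ⋆ G ≋ (λ _ → 0#)
  ⋆-zeroˡ G zero = zeroˡ _
  ⋆-zeroˡ G (suc n) = trans (+-cong (zeroˡ _) (⋆-zeroˡ G n)) (+-identityˡ _)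

  ⋆-distribʳ-⊕ : ∀ F F′ G → (F ⊕ F′) ⋆ G ≋ F ⋆ G ⊕ F′ ⋆ G
  ⋆-distribʳ-⊕ F F′ G zero = distribʳ _ _ _
  ⋆-distribʳ-⊕ F F′ G (suc n) =
    trans (+-cong (distribʳ _ _ _) (⋆-distribʳ-⊕ (tail F) (tail F′) G n)) (+-interchange _ _ _ _)

  ⋆-scaleˡ : ∀ a F G → (λ i → a * F i) ⋆ G ≋ (λ n → a * (F ⋆ G) n)
  ⋆-scaleˡ a F G zero = *-assoc _ _ _
  ⋆-scaleˡ a F G (suc n) = trans (+-cong (*-assoc _ _ _) (⋆-scaleˡ a (tail F) G n)) (sym (distribˡ _ _ _))

  ⋆-negʳ : ∀ F G → F ⋆ (⊝ G) ≋ ⊝ (F ⋆ G)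
  ⋆-negʳ F G zero = sym (-‿distribʳ-* _ _)
  ⋆-negʳ F G (suc n) = trans (+-cong (sym (-‿distribʳ-* _ _)) (⋆-negʳ (tail F) G n)) (-‿+-comm _ _)

  ⋆-comm : ∀ F G → F ⋆ G ≋ G ⋆ F
  ⋆-comm F G zero = *-comm _ _
  ⋆-comm F G (suc zero) = solve 4 (λ a b c d → a :* b :+ c :* d := d :* c :+ b :* a) refl _ _ _ _
  ⋆-comm F G (suc (suc n)) = begin
    F 0 * G (2 ℕ.+ n) + (tail F ⋆ G) (suc n)
      ≈⟨ +-congˡ (⋆-comm (tail F) G (suc n)) ⟩
    F 0 * G (2 ℕ.+ n) + (G 0 * F (2 ℕ.+ n) + (tail G ⋆ tail F) n)
      ≈⟨ +-congˡ (+-congˡ (⋆-comm (tail G) (tail F) n)) ⟩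
    F 0 * G (2 ℕ.+ n) + (G 0 * F (2 ℕ.+ n) + (tail F ⋆ tail G) n)
      ≈⟨ solve 3 (λ a b x → a :+ (b :+ x) := b :+ (a :+ x)) refl _ _ _ ⟩
    G 0 * F (2 ℕ.+ n) + (F 0 * G (2 ℕ.+ n) + (tail F ⋆ tail G) n)
      ≈⟨ +-congˡ (⋆-comm F (tail G) (suc n)) ⟩
    G 0 * F (2 ℕ.+ n) + (tail G ⋆ F) (suc n)                        ∎

  ⋆-assoc : ∀ F G H → (F ⋆ G) ⋆ H ≋ F ⋆ (G ⋆ H)
  ⋆-assoc F G H zero = *-assoc _ _ _
  ⋆-assoc F G H (suc n) = begin
    (F 0 * G 0) * H (suc n) + ((F₀G₊ ⊕ tail F ⋆ G) ⋆ H) n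
      ≈⟨ +-congˡ (⋆-distribʳ-⊕ F₀G₊ (tail F ⋆ G) H n) ⟩
    (F 0 * G 0) * H (suc n) + ((F₀G₊ ⋆ H) n + ((tail F ⋆ G) ⋆ H) n)
      ≈⟨ +-congˡ (+-cong (⋆-scaleˡ (F 0) (tail G) H n) (⋆-assoc (tail F) G H n)) ⟩
    (F 0 * G 0) * H (suc n) + (F 0 * (tail G ⋆ H) n + (tail F ⋆ (G ⋆ H)) n)
      ≈⟨ solve 5 (λ f g h x y → (f :* g) :* h :+ (f :* x :+ y) := f :* (g :* h :+ x) :+ y) refl _ _ _ _ _ ⟩
    F 0 * (G 0 * H (suc n) + (tail G ⋆ H) n) + (tail F ⋆ (G ⋆ H)) n ∎
    where
    F₀G₊ : Series
    F₀G₊ i = F 0 * G (suc i)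

  D-⋆ : ∀ F G → D (F ⋆ G) ≋ D F ⋆ G ⊕ F ⋆ D G
  D-⋆ F G zero = solve 2 (λ f g → con (+ 0) :* (f :* g) := (con (+ 0) :* f) :* g :+ f :* (con (+ 0) :* g)) refl _ _
  D-⋆ F G (suc n) = begin
    ι (suc n) * (F 0 * G (suc n) + X)                         ≈⟨ *-congʳ (ι-suc n) ⟩
    (1# + ι n) * (F 0 * G (suc n) + X)                        ≈⟨ expand _ _ _ _ ⟩
    X + F 0 * DG + ι n * X                                    ≈⟨ +-congˡ (D-⋆ (tail F) G n) ⟩
    X + F 0 * DG + ((D (tail F) ⋆ G) n + (tail F ⋆ D G) n)    ≈⟨ regroup _ _ _ _ _ _ ⟩
    (0# * F 0) * G (suc n) + (X + (D (tail F) ⋆ G) n) + (F 0 * DG + (tail F ⋆ D G) n)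
      ≈⟨ +-cong (+-congˡ (sym (⋆-distribʳ-⊕ (tail F) (D (tail F)) G n)))
                (+-congʳ (*-congˡ (*-congʳ (sym (ι-suc n))))) ⟩
    (0# * F 0) * G (suc n) + ((tail F ⊕ D (tail F)) ⋆ G) n + (F ⋆ D G) (suc n)
      ≈⟨ +-congʳ (+-congˡ (⋆-cong tail-D (λ _ → refl) n)) ⟩
    (D F ⋆ G) (suc n) + (F ⋆ D G) (suc n)                     ∎
    where
    X = (tail F ⋆ G) n
    DG = (1# + ι n) * G (suc n)
    expand : ∀ k f g x → (1# + k) * (f * g + x) ≈ x + f * ((1# + k) * g) + k * x
    expand = solve 4 (λ k f g x → (con (+ 1) :+ k) :* (f :* g :+ x) := x :+ f :* ((con (+ 1) :+ k) :* g) :+ k :* x) refl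
    regroup : ∀ f g x y y′ z → x + z + (y + y′) ≈ (0# * f) * g + (x + y) + (z + y′)
    regroup = solve 6 (λ f g x y y′ z → x :+ z :+ (y :+ y′) := (con (+ 0) :* f) :* g :+ (x :+ y) :+ (z :+ y′)) refl
    tail-D : tail F ⊕ D (tail F) ≋ tail (D F)
    tail-D i = sym (trans (*-congʳ (ι-suc i)) (trans (distribʳ _ _ _) (+-congʳ (*-identityˡ _))))

  LogDeriv : Series → Series → Set ℓ
  LogDeriv F q = ∀ n → (q ⋆ F) n ≈ - (ι (suc n) * F (suc n))

  logDeriv⇒euler : ∀ {F q} → LogDeriv F q → shift q ⋆ F ≋ ⊝ D F
  logDeriv⇒euler q⋆F zero = trans (zeroˡ _) (trans (sym -0#≈0#) (-‿cong (sym (zeroˡ _))))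
  logDeriv⇒euler q⋆F (suc n) = trans (+-cong (zeroˡ _) (q⋆F n)) (+-identityˡ _)

  euler⇒logDeriv : ∀ {F q} → shift q ⋆ F ≋ ⊝ D F → LogDeriv F q
  euler⇒logDeriv tq⋆F n = trans (sym (trans (+-congʳ (zeroˡ _)) (+-identityˡ _))) (tq⋆F (suc n))

  logDeriv-⋆ : ∀ {F G q r} → LogDeriv F q → LogDeriv G r → LogDeriv (F ⋆ G) (q ⊕ r)
  logDeriv-⋆ {F} {G} {q} {r} F-logDeriv G-logDeriv = euler⇒logDeriv λ n → begin
    (shift (q ⊕ r) ⋆ (F ⋆ G)) n                     ≈⟨ ⋆-cong shift-⊕ (λ _ → refl) n ⟩
    ((shift q ⊕ shift r) ⋆ (F ⋆ G)) n               ≈⟨ ⋆-distribʳ-⊕ (shift q) (shift r) (F ⋆ G) n ⟩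
    (shift q ⋆ (F ⋆ G)) n + (shift r ⋆ (F ⋆ G)) n   ≈⟨ +-cong (via-F n) (via-G n) ⟩
    - (D F ⋆ G) n + - (F ⋆ D G) n                   ≈⟨ -‿+-comm _ _ ⟩
    - ((D F ⋆ G) n + (F ⋆ D G) n)                   ≈⟨ -‿cong (D-⋆ F G n) ⟨
    - D (F ⋆ G) n                                   ∎
    where
    shift-⊕ : shift (q ⊕ r) ≋ shift q ⊕ shift r
    shift-⊕ zero = sym (+-identityˡ 0#)
    shift-⊕ (suc n) = refl
    via-F : shift q ⋆ (F ⋆ G) ≋ ⊝ (D F ⋆ G)
    via-F n = begin
      (shift q ⋆ (F ⋆ G)) n     ≈⟨ ⋆-assoc (shift q) F G n ⟨
      ((shift q ⋆ F) ⋆ G) n     ≈⟨ ⋆-comm (shift q ⋆ F) G n ⟩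
      (G ⋆ (shift q ⋆ F)) n     ≈⟨ ⋆-cong (λ _ → refl) (logDeriv⇒euler F-logDeriv) n ⟩
      (G ⋆ (⊝ D F)) n           ≈⟨ ⋆-negʳ G (D F) n ⟩
      - (G ⋆ D F) n             ≈⟨ -‿cong (⋆-comm G (D F) n) ⟩
      - (D F ⋆ G) n             ∎
    via-G : shift r ⋆ (F ⋆ G) ≋ ⊝ (F ⋆ D G)
    via-G n = begin
      (shift r ⋆ (F ⋆ G)) n     ≈⟨ ⋆-cong (λ _ → refl) (⋆-comm F G) n ⟩
      (shift r ⋆ (G ⋆ F)) n     ≈⟨ ⋆-assoc (shift r) G F n ⟨
      ((shift r ⋆ G) ⋆ F) n     ≈⟨ ⋆-comm (shift r ⋆ G) F n ⟩
      (F ⋆ (shift r ⋆ G)) n     ≈⟨ ⋆-cong (λ _ → refl) (logDeriv⇒euler G-logDeriv) n ⟩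
      (F ⋆ (⊝ D G)) n           ≈⟨ ⋆-negʳ F (D G) n ⟩
      - (F ⋆ D G) n             ∎

  difference-of-solutions : ∀ {x₀ y₀ a b ρ k x y} → x₀ ≈ 1# → y₀ ≈ 1# →
                            x₀ * a + ρ ≈ - (k * x) → y₀ * b + ρ ≈ - (k * y) → a - b ≈ k * (y - x)
  difference-of-solutions {x₀} {y₀} {a} {b} {ρ} {k} {x} {y} x₀≈1 y₀≈1 x-eq y-eq = begin
    a - b
      ≈⟨ solve 3 (λ a b ρ → a :- b := (con (+ 1) :* a :+ ρ) :- (con (+ 1) :* b :+ ρ)) refl a b ρ ⟩
    (1# * a + ρ) - (1# * b + ρ)    ≈⟨ +-cong (trans (+-congʳ (*-congʳ (sym x₀≈1))) x-eq)
                                             (-‿cong (trans (+-congʳ (*-congʳ (sym y₀≈1))) y-eq)) ⟩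
    - (k * x) - - (k * y)          ≈⟨ solve 3 (λ k x y → (:- (k :* x)) :- (:- (k :* y)) := k :* (y :- x)) refl k x y ⟩
    k * (y - x)                    ∎

  logDeriv-difference : ∀ {X Y u w} N → LogDeriv X u → LogDeriv Y w → X 0 ≈ 1# → Y 0 ≈ 1# →
                        (∀ i → i ≤ N → X i ≈ Y i) → (∀ m → m < N → u m ≈ w m) →
                        u N - w N ≈ ι (suc N) * (Y (suc N) - X (suc N))
  logDeriv-difference zero X-logDeriv Y-logDeriv X₀ Y₀ _ _ =
    difference-of-solutions X₀ Y₀ (trans (+-identityʳ _) (trans (*-comm _ _) (X-logDeriv 0)))
                                  (trans (+-identityʳ _) (trans (*-comm _ _) (Y-logDeriv 0)))
  logDeriv-difference {X} {Y} {u} {w} (suc N) X-logDeriv Y-logDeriv X₀ Y₀ X≈Y u≈w =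
    difference-of-solutions X₀ Y₀ (trans (⋆-comm X u (suc N)) (X-logDeriv (suc N)))
                                  (trans (+-congˡ lower-terms) (trans (⋆-comm Y w (suc N)) (Y-logDeriv (suc N))))
    where
    lower-terms : (tail X ⋆ u) N ≈ (tail Y ⋆ w) N
    lower-terms = ⋆-cong≤ N (λ i i≤N → X≈Y (suc i) (s≤s i≤N)) (λ i i≤N → u≈w i (s≤s i≤N))

  monomial : ℕ → Carrier → Series
  monomial zero v zero = v
  monomial zero v (suc n) = 0#
  monomial (suc k) v zero = 0#
  monomial (suc k) v (suc n) = monomial k v n

  monomial-self : ∀ k v → monomial k v k ≡ v
  monomial-self zero v = ≡.refl
  monomial-self (suc k) v = monomial-self k v

  monomial-≢ : ∀ k v {n} → n ≢ k → monomial k v n ≡ 0#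
  monomial-≢ zero v {zero} n≢k = contradiction ≡.refl n≢k
  monomial-≢ zero v {suc n} n≢k = ≡.refl
  monomial-≢ (suc k) v {zero} n≢k = ≡.refl
  monomial-≢ (suc k) v {suc n} n≢k = monomial-≢ k v (n≢k ∘ ≡.cong suc)

  monomial-⋆-< : ∀ k v G {n} → n < k → (monomial k v ⋆ G) n ≈ 0#
  monomial-⋆-< (suc k) v G {zero} _ = zeroˡ _
  monomial-⋆-< (suc k) v G {suc n} (s≤s n<k) = trans (+-cong (zeroˡ _) (monomial-⋆-< k v G n<k)) (+-identityˡ _)

  monomial-⋆-+ : ∀ k v G i → (monomial k v ⋆ G) (k ℕ.+ i) ≈ v * G i
  monomial-⋆-+ zero v G zero = refl
  monomial-⋆-+ zero v G (suc i) = trans (+-congˡ (⋆-zeroˡ G i)) (+-identityʳ _)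
  monomial-⋆-+ (suc k) v G i = trans (+-cong (zeroˡ _) (monomial-⋆-+ k v G i)) (+-identityˡ _)

  stretched : Series → ℕ → ℕ → Carrier
  stretched f zero q = f q
  stretched f (suc r) q = 0#

  -- stretch k f = f(t^{k+1}): the coefficient of t^{r + q(k+1)}, r ≤ k, is f q if r = 0 and 0 otherwise.
  stretch : ℕ → Series → Series
  stretch k f n = stretched f (n % suc k) (n / suc k)

  stretch-suc-< : ∀ k f {n} → n < k → stretch k f (suc n) ≡ 0#
  stretch-suc-< k f {n} n<k = ≡.cong (λ r → stretched f r (suc n / suc k)) (m<n⇒m%n≡m (s≤s n<k))

  stretch-+ : ∀ k f i → stretch k f (suc k ℕ.+ i) ≡ stretch k (tail f) i
  stretch-+ k f i = ≡.trans (≡.cong₂ (stretched f) remainder quotient) (stretched-suc (i % suc k))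
    where
    remainder : (suc k ℕ.+ i) % suc k ≡ i % suc k
    remainder = ≡.trans (≡.cong (_% suc k) (ℕP.+-comm (suc k) i)) ([m+n]%n≡m%n i (suc k))
    quotient : (suc k ℕ.+ i) / suc k ≡ suc (i / suc k)
    quotient = ≡.trans (+-distrib-/-∣ˡ i ∣-refl) (≡.cong (ℕ._+ i / suc k) (n/n≡1 (suc k)))
    stretched-suc : ∀ r → stretched f r (suc (i / suc k)) ≡ stretched (tail f) r (i / suc k)
    stretched-suc zero = ≡.refl
    stretched-suc (suc r) = ≡.refl

  stretch-suc-∈ : ∀ {p} (P : Carrier → Set p) k f → P 0# → (∀ m → P (f (suc m))) →
                  ∀ n → P (stretch k f (suc n))
  stretch-suc-∈ P k f P0 Pf n = at (suc n % suc k) (suc n / suc k) (m≡m%n+[m/n]*n (suc n) (suc k))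
    where
    at : ∀ r q → suc n ≡ r ℕ.+ q ℕ.* suc k → P (stretched f r q)
    at zero zero ()
    at zero (suc q) _ = Pf q
    at (suc r) q _ = P0

  module _ (k : ℕ) (a : Carrier) (f : Series) (f′≈af : ∀ m → ι (suc m) * f (suc m) ≈ a * f m) where

    stretch-ode : ∀ i → ι (suc k ℕ.+ i) * stretch k f (suc k ℕ.+ i) ≈ ι (suc k) * a * stretch k f i
    stretch-ode i = begin
      ι (suc k ℕ.+ i) * stretch k f (suc k ℕ.+ i)   ≡⟨ ≡.cong (ι (suc k ℕ.+ i) *_) (stretch-+ k f i) ⟩
      ι (suc k ℕ.+ i) * stretch k (tail f) i        ≈⟨ at i (i % suc k) (i / suc k) (m≡m%n+[m/n]*n i (suc k)) ⟩
      ι (suc k) * a * stretch k f i                 ∎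
      where
      at : ∀ i r q → i ≡ r ℕ.+ q ℕ.* suc k →
           ι (suc k ℕ.+ i) * stretched (tail f) r q ≈ ι (suc k) * a * stretched f r q
      at _ zero q ≡.refl = begin
        ι (suc q ℕ.* suc k) * f (suc q)       ≈⟨ *-congʳ (ι-* (suc q) (suc k)) ⟩
        ι (suc q) * ι (suc k) * f (suc q)     ≈⟨ solve 3 (λ x y z → x :* y :* z := y :* (x :* z)) refl _ _ _ ⟩
        ι (suc k) * (ι (suc q) * f (suc q))   ≈⟨ *-congˡ (f′≈af q) ⟩
        ι (suc k) * (a * f q)                 ≈⟨ *-assoc _ _ _ ⟨
        ι (suc k) * a * f q                   ∎
      at _ (suc r) q _ = trans (zeroʳ _) (sym (zeroʳ _))

    logDeriv-stretch : LogDeriv (stretch k f) (monomial k (- (ι (suc k) * a)))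
    logDeriv-stretch n with n ℕ.<? k
    ... | yes n<k = begin
      (monomial k _ ⋆ stretch k f) n           ≈⟨ monomial-⋆-< k _ (stretch k f) n<k ⟩
      0#                                       ≈⟨ trans (-‿cong (zeroʳ _)) -0#≈0# ⟨
      - (ι (suc n) * 0#)                       ≡⟨ ≡.cong (λ x → - (ι (suc n) * x)) (stretch-suc-< k f n<k) ⟨
      - (ι (suc n) * stretch k f (suc n))      ∎
    ... | no n≮k with ℕP.m≤n⇒∃[o]m+o≡n (ℕP.≮⇒≥ n≮k)
    ...   | i , ≡.refl = begin
      (monomial k _ ⋆ stretch k f) (k ℕ.+ i)   ≈⟨ monomial-⋆-+ k _ (stretch k f) i ⟩
      - (ι (suc k) * a) * stretch k f i        ≈⟨ -‿distribˡ-* _ _ ⟨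
      - (ι (suc k) * a * stretch k f i)        ≈⟨ -‿cong (stretch-ode i) ⟨
      - (ι (suc k ℕ.+ i) * stretch k f (suc k ℕ.+ i)) ∎

module TorsionFreeRing {c ℓ : Level} (R : CommutativeRing c ℓ) (torsionFree : RingDefs.TorsionFree R) where
  open CommutativeRing R
  open IntegerCoefficients R
  open PowerSeries R
  open import Algebra.Properties.Ring ring using (x∙y⁻¹≈ε⇒x≈y; x≈y⇒x∙y⁻¹≈ε)
  open import Relation.Binary.Reasoning.Setoid setoid

  ι*x≈0⇒x≈0 : ∀ n {x} → 1 ≤ n → ι n * x ≈ 0# → x ≈ 0#
  ι*x≈0⇒x≈0 n {x} 1≤n ιx≈0 = torsionFree n x 1≤n (trans (·≈ι* n x) ιx≈0)

  ≤-extend : ∀ {p} {P : ℕ → Set p} {N} → (∀ i → i ≤ N → P i) → P (suc N) → ∀ i → i ≤ suc N → P i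
  ≤-extend P≤N P[1+N] i i≤1+N with ℕP.m≤n⇒m<n∨m≡n i≤1+N
  ... | inj₁ (s≤s i≤N) = P≤N i i≤N
  ... | inj₂ ≡.refl = P[1+N]

  logDeriv-unique : ∀ {X Y u w} N → LogDeriv X u → LogDeriv Y w → X 0 ≈ 1# → Y 0 ≈ 1# →
                    (∀ m → m < N → u m ≈ w m) → ∀ i → i ≤ N → X i ≈ Y i
  logDeriv-unique zero _ _ X₀ Y₀ _ .0 z≤n = trans X₀ (sym Y₀)
  logDeriv-unique {X} {Y} {u} {w} (suc N) X-logDeriv Y-logDeriv X₀ Y₀ u≈w = ≤-extend lower top
    where
    u≈w-below : ∀ m → m < N → u m ≈ w m
    u≈w-below m m<N = u≈w m (ℕP.m<n⇒m<1+n m<N)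
    lower : ∀ i → i ≤ N → X i ≈ Y i
    lower = logDeriv-unique N X-logDeriv Y-logDeriv X₀ Y₀ u≈w-below
    top : X (suc N) ≈ Y (suc N)
    top = sym (x∙y⁻¹≈ε⇒x≈y _ _ (ι*x≈0⇒x≈0 (suc N) (s≤s z≤n) (begin
      ι (suc N) * (Y (suc N) - X (suc N))   ≈⟨ logDeriv-difference N X-logDeriv Y-logDeriv X₀ Y₀ lower u≈w-below ⟨
      u N - w N                             ≈⟨ x≈y⇒x∙y⁻¹≈ε (u≈w N ℕP.≤-refl) ⟩
      0#                                    ∎)))

module SignProperties {c ℓ : Level} (R : CommutativeRing c ℓ) where
  open CommutativeRing R
  open RingDefs R
  open IntegerCoefficients R
  open import Algebra.Properties.Ring ring using (-‿distribˡ-*)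

  sgn-cong : ∀ n {x y} → x ≈ y → sgn n x ≈ sgn n y
  sgn-cong zero x≈y = x≈y
  sgn-cong (suc n) x≈y = -‿cong (sgn-cong n x≈y)

  sgn-*ˡ : ∀ n x y → sgn n (x * y) ≈ sgn n x * y
  sgn-*ˡ zero x y = refl
  sgn-*ˡ (suc n) x y = trans (-‿cong (sgn-*ˡ n x y)) (-‿distribˡ-* _ _)

  sgn[x]-sgn[y]≈sgn[x-y] : ∀ n x y → sgn n x - sgn n y ≈ sgn n (x - y)
  sgn[x]-sgn[y]≈sgn[x-y] zero x y = refl
  sgn[x]-sgn[y]≈sgn[x-y] (suc n) x y =
    trans (solve 2 (λ a b → (:- a) :- (:- b) := :- (a :- b)) refl _ _) (-‿cong (sgn[x]-sgn[y]≈sgn[x-y] n x y))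

module IdealProperties {c ℓ ℓ′ : Level} (R : CommutativeRing c ℓ) {𝔞 : CommutativeRing.Carrier R → Set ℓ′}
                       (𝔞-ideal : RingDefs.IsIdeal R 𝔞) where
  open CommutativeRing R
  open RingDefs R
  open IsIdeal 𝔞-ideal
  open IntegerCoefficients R
  open PowerSeries R
  open SignProperties R using (sgn[x]-sgn[y]≈sgn[x-y])
  open import Algebra.Properties.Ring ring using (-1*x≈-x; x≈y⇒x∙y⁻¹≈ε; -‿involutive)
  open import Relation.Binary.Reasoning.Setoid setoid

  -‿closed : ∀ {x} → 𝔞 x → 𝔞 (- x)
  -‿closed x∈𝔞 = resp (-1*x≈-x _) (*-closed (- 1#) x∈𝔞)

  congMod-reflexive : ∀ {x y} → x ≈ y → CongMod 𝔞 x y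
  congMod-reflexive x≈y = resp (sym (x≈y⇒x∙y⁻¹≈ε x≈y)) zero∈

  congMod-sym : ∀ {x y} → CongMod 𝔞 x y → CongMod 𝔞 y x
  congMod-sym x≡y = resp (solve 2 (λ x y → :- (x :- y) := y :- x) refl _ _) (-‿closed x≡y)

  congMod-trans : ∀ {x y z} → CongMod 𝔞 x y → CongMod 𝔞 y z → CongMod 𝔞 x z
  congMod-trans x≡y y≡z = resp (solve 3 (λ x y z → (x :- y) :+ (y :- z) := x :- z) refl _ _ _) (+-closed x≡y y≡z)

  sgn-closed : ∀ n {x} → 𝔞 x → 𝔞 (sgn n x)
  sgn-closed zero x∈𝔞 = x∈𝔞
  sgn-closed (suc n) x∈𝔞 = -‿closed (sgn-closed n x∈𝔞)

  sgn-closed⁻¹ : ∀ n {x} → 𝔞 (sgn n x) → 𝔞 x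
  sgn-closed⁻¹ zero x∈𝔞 = x∈𝔞
  sgn-closed⁻¹ (suc n) x∈𝔞 = sgn-closed⁻¹ n (resp (-‿involutive _) (-‿closed x∈𝔞))

  congMod-sgn : ∀ n {x y} → CongMod 𝔞 x y → CongMod 𝔞 (sgn n x) (sgn n y)
  congMod-sgn n x≡y = resp (sym (sgn[x]-sgn[y]≈sgn[x-y] n _ _)) (sgn-closed n x≡y)

  congMod-sgn⁻¹ : ∀ n {x y} → CongMod 𝔞 (sgn n x) (sgn n y) → CongMod 𝔞 x y
  congMod-sgn⁻¹ n x≡y = sgn-closed⁻¹ n (resp (sgn[x]-sgn[y]≈sgn[x-y] n _ _) x≡y)

  ⋆-closedˡ : ∀ F G → (∀ i → 𝔞 (F i)) → ∀ n → 𝔞 ((F ⋆ G) n)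
  ⋆-closedˡ F G F∈𝔞 zero = resp (*-comm _ _) (*-closed (G 0) (F∈𝔞 0))
  ⋆-closedˡ F G F∈𝔞 (suc n) =
    +-closed (resp (*-comm _ _) (*-closed (G (suc n)) (F∈𝔞 0))) (⋆-closedˡ (tail F) G (F∈𝔞 ∘ suc) n)

  ⋆-congMod : ∀ E X → X 0 ≈ 1# → (∀ n → 𝔞 (X (suc n))) → ∀ n → CongMod 𝔞 ((E ⋆ X) (suc n)) (E (suc n))
  ⋆-congMod E X X₀ X₊∈𝔞 n = resp (sym difference) (⋆-closedˡ (tail X) E X₊∈𝔞 n)
    where
    difference : (E ⋆ X) (suc n) - E (suc n) ≈ (tail X ⋆ E) n
    difference = begin
      (E ⋆ X) (suc n) - E (suc n)                     ≈⟨ +-congʳ (⋆-comm E X (suc n)) ⟩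
      (X 0 * E (suc n) + (tail X ⋆ E) n) - E (suc n)  ≈⟨ +-congʳ (+-congʳ (*-congʳ X₀)) ⟩
      (1# * E (suc n) + (tail X ⋆ E) n) - E (suc n)   ≈⟨ solve 2 (λ e ρ → (con (+ 1) :* e :+ ρ) :- e := ρ) refl _ _ ⟩
      (tail X ⋆ E) n                                  ∎

module DividedPowerIdeal {c ℓ ℓ′ : Level} (R : CommutativeRing c ℓ) (torsionFree : RingDefs.TorsionFree R)
                         {𝔞 : CommutativeRing.Carrier R → Set ℓ′} (𝔞-ideal : RingDefs.IsIdeal R 𝔞)
                         (𝔞-dividedPower : RingDefs.IsDividedPower R 𝔞) where
  open CommutativeRing R
  open RingDefs R
  open IsIdeal 𝔞-ideal
  open IntegerCoefficients R
  open PowerSeries R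
  open TorsionFreeRing R torsionFree
  open IdealProperties R 𝔞-ideal
  open import Algebra.Properties.Ring ring using (x∙y⁻¹≈ε⇒x≈y)
  open import Relation.Binary.Reasoning.Setoid setoid

  γ : (x : Carrier) → 𝔞 x → Series
  γ x x∈𝔞 zero = 1#
  γ x x∈𝔞 (suc m) = proj₁ (𝔞-dividedPower x x∈𝔞 (suc m) (s≤s z≤n))

  γ-closed : ∀ x x∈𝔞 m → 𝔞 (γ x x∈𝔞 (suc m))
  γ-closed x x∈𝔞 m = proj₁ (proj₂ (𝔞-dividedPower x x∈𝔞 (suc m) (s≤s z≤n)))

  pow≈ι[m!]*γ : ∀ x x∈𝔞 m → pow x m ≈ ι (m !) * γ x x∈𝔞 m
  pow≈ι[m!]*γ x x∈𝔞 zero = sym (*-identityˡ 1#)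
  pow≈ι[m!]*γ x x∈𝔞 (suc m) =
    trans (proj₂ (proj₂ (𝔞-dividedPower x x∈𝔞 (suc m) (s≤s z≤n)))) (·≈ι* (suc m !) _)

  γ-suc : ∀ x x∈𝔞 m → ι (suc m) * γ x x∈𝔞 (suc m) ≈ x * γ x x∈𝔞 m
  γ-suc x x∈𝔞 m = x∙y⁻¹≈ε⇒x≈y _ _ (ι*x≈0⇒x≈0 (m !) (ℕP.1≤n! m) (begin
    ι (m !) * (ι (suc m) * g′ - x * g)
      ≈⟨ solve 5 (λ k l g′ x g → k :* (l :* g′ :- x :* g) := (l :* k) :* g′ :- x :* (k :* g)) refl _ _ _ _ _ ⟩
    (ι (suc m) * ι (m !)) * g′ - x * (ι (m !) * g)
      ≈⟨ +-cong (*-congʳ (ι-* (suc m) (m !))) (-‿cong (*-congˡ (pow≈ι[m!]*γ x x∈𝔞 m))) ⟨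
    ι (suc m !) * g′ - x * pow x m             ≈⟨ +-congʳ (pow≈ι[m!]*γ x x∈𝔞 (suc m)) ⟨
    pow x (suc m) - x * pow x m                ≈⟨ -‿inverseʳ _ ⟩
    0#                                         ∎))
    where
    g = γ x x∈𝔞 m
    g′ = γ x x∈𝔞 (suc m)

  module Comparison {F F′ q q′ : Series} (F₀ : F 0 ≈ 1#) (F′₀ : F′ 0 ≈ 1#)
                    (F-logDeriv : LogDeriv F q) (F′-logDeriv : LogDeriv F′ q′) where

    CoeffCong : ℕ → Set ℓ′
    CoeffCong N = ∀ m → m < N → CongMod 𝔞 (F (suc m)) (F′ (suc m))

    LogDerivCong : ℕ → Set (c Level.⊔ ℓ Level.⊔ ℓ′)
    LogDerivCong N = ∀ m → m < N → CongModMul 𝔞 (suc m) (q m) (q′ m)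

    -- E = F ∏_{m<N} exp(c_m t^{m+1}), where (m+1) c_m = q_m - q′_m.
    record Correction (N : ℕ) : Set (c Level.⊔ ℓ Level.⊔ ℓ′) where
      field
        E r : Series
        E₀ : E 0 ≈ 1#
        E≡F : ∀ n → CongMod 𝔞 (E (suc n)) (F (suc n))
        E-logDeriv : LogDeriv E r
        r≈q′ : ∀ m → m < N → r m ≈ q′ m
        r≈q : ∀ m → N ≤ m → r m ≈ q m

      E≈F′ : ∀ i → i ≤ N → E i ≈ F′ i
      E≈F′ = logDeriv-unique N E-logDeriv F′-logDeriv E₀ F′₀ r≈q′

      q-q′≈ : q N - q′ N ≈ ι (suc N) * (F′ (suc N) - E (suc N))
      q-q′≈ = trans (+-congʳ (sym (r≈q N ℕP.≤-refl)))
                    (logDeriv-difference N E-logDeriv F′-logDeriv E₀ F′₀ E≈F′ r≈q′)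

    correction-step : ∀ {N} → Correction N → CongModMul 𝔞 (suc N) (q N) (q′ N) → Correction (suc N)
    correction-step {N} C (a , a∈𝔞 , q-q′≈[1+N]·a) = record
      { E = E ⋆ X
      ; r = r ⊕ monomial N v
      ; E₀ = trans (*-identityʳ _) E₀
      ; E≡F = λ n → congMod-trans (⋆-congMod E X refl X₊∈𝔞 n) (E≡F n)
      ; E-logDeriv = logDeriv-⋆ E-logDeriv (logDeriv-stretch N a (γ a a∈𝔞) (γ-suc a a∈𝔞))
      ; r≈q′ = r′≈q′
      ; r≈q = λ m N<m → trans (r′≈r m (ℕP.<⇒≢ N<m ∘ ≡.sym)) (r≈q m (ℕP.<⇒≤ N<m))
      }
      where
      open Correction C
      X = stretch N (γ a a∈𝔞)
      v = - (ι (suc N) * a)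
      X₊∈𝔞 : ∀ n → 𝔞 (X (suc n))
      X₊∈𝔞 = stretch-suc-∈ 𝔞 N (γ a a∈𝔞) zero∈ (γ-closed a a∈𝔞)
      r′≈r : ∀ m → m ≢ N → r m + monomial N v m ≈ r m
      r′≈r m m≢N = trans (+-congˡ (reflexive (monomial-≢ N v m≢N))) (+-identityʳ _)
      r′≈q′ : ∀ m → m < suc N → r m + monomial N v m ≈ q′ m
      r′≈q′ m m<1+N with ℕP.m<1+n⇒m<n∨m≡n m<1+N
      ... | inj₁ m<N = trans (r′≈r m (ℕP.<⇒≢ m<N)) (r≈q′ m m<N)
      ... | inj₂ ≡.refl = begin
        r N + monomial N v N    ≈⟨ +-cong (r≈q N ℕP.≤-refl) (reflexive (monomial-self N v)) ⟩
        q N - ι (suc N) * a     ≈⟨ +-congˡ (-‿cong (trans (sym (·≈ι* (suc N) a)) (sym q-q′≈[1+N]·a))) ⟩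
        q N - (q N - q′ N)      ≈⟨ solve 2 (λ x y → x :- (x :- y) := y) refl _ _ ⟩
        q′ N                    ∎

    correction : ∀ N → LogDerivCong N → Correction N
    correction zero _ = record
      { E = F ; r = q ; E₀ = F₀ ; E≡F = λ _ → congMod-reflexive refl ; E-logDeriv = F-logDeriv
      ; r≈q′ = λ _ () ; r≈q = λ _ _ → refl }
    correction (suc N) h = correction-step (correction N (λ m m<N → h m (ℕP.m<n⇒m<1+n m<N))) (h N ℕP.≤-refl)

    logDerivCong⇒coeffCong : ∀ N → LogDerivCong N → CoeffCong N
    logDerivCong⇒coeffCong N h m m<N = congMod-trans (congMod-sym (E≡F m)) (congMod-reflexive (E≈F′ (suc m) m<N))
      where open Correction (correction N h)

    coeffCong⇒logDerivCong : ∀ N → CoeffCong N → LogDerivCong N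
    coeffCong⇒logDerivCong zero _ _ ()
    coeffCong⇒logDerivCong (suc N) h m m<1+N with ℕP.m<1+n⇒m<n∨m≡n m<1+N
    ... | inj₁ m<N = coeffCong⇒logDerivCong N (λ k k<N → h k (ℕP.m<n⇒m<1+n k<N)) m m<N
    ... | inj₂ ≡.refl = F′ (suc N) - E (suc N) , F′≡E , trans q-q′≈ (sym (·≈ι* (suc N) _))
      where
      open Correction (correction N (coeffCong⇒logDerivCong N (λ k k<N → h k (ℕP.m<n⇒m<1+n k<N))))
      F′≡E : CongMod 𝔞 (F′ (suc N)) (E (suc N))
      F′≡E = congMod-trans (congMod-sym (h N ℕP.≤-refl)) (congMod-sym (E≡F N))

module PolynomialSeries {c ℓ : Level} (R : CommutativeRing c ℓ) {d : ℕ} (v : Vec (CommutativeRing.Carrier R) d) where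
  open CommutativeRing R
  open RingDefs R
  open Newton (e v)
  open IntegerCoefficients R
  open PowerSeries R
  open SignProperties R
  open import Algebra.Properties.Ring ring using (-‿+-comm)
  open import Relation.Binary.Reasoning.Setoid setoid

  F : Series
  F n = sgn n (e v n)

  q : Series
  q m = p v (suc m)

  sgn[e*y]≈-[F*y] : ∀ i y → sgn i (e v (suc i) * y) ≈ - (F (suc i) * y)
  sgn[e*y]≈-[F*y] i y = trans (sgn-*ˡ i _ _) (solve 2 (λ s y → s :* y := :- ((:- s) :* y)) refl _ _)

  go-ps : ∀ i n → go (suc i) (ps (suc n)) ≈ - ((λ j → F (suc (i ℕ.+ j))) ⋆ q) n
  go-ps i zero = begin
    sgn i (e v (suc i) * q 0) + 0#   ≈⟨ +-identityʳ _ ⟩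
    sgn i (e v (suc i) * q 0)        ≈⟨ sgn[e*y]≈-[F*y] i (q 0) ⟩
    - (F (suc i) * q 0)              ≡⟨ ≡.cong (λ k → - (F (suc k) * q 0)) (ℕP.+-identityʳ i) ⟨
    - (F (suc (i ℕ.+ 0)) * q 0)      ∎
  go-ps i (suc n) = begin
    sgn i (e v (suc i) * q (suc n)) + go (2 ℕ.+ i) (ps (suc n))
      ≈⟨ +-cong (sgn[e*y]≈-[F*y] i (q (suc n))) (go-ps (suc i) n) ⟩
    - (F (suc i) * q (suc n)) + - ((λ j → F (2 ℕ.+ i ℕ.+ j)) ⋆ q) n
      ≈⟨ -‿+-comm _ _ ⟩
    - (F (suc i) * q (suc n) + ((λ j → F (2 ℕ.+ i ℕ.+ j)) ⋆ q) n)
      ≈⟨ -‿cong (+-cong (*-congʳ (reflexive (≡.cong (F ∘ suc) (≡.sym (ℕP.+-identityʳ i)))))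
                        (⋆-cong (λ j → reflexive (≡.cong (F ∘ suc) (≡.sym (ℕP.+-suc i j)))) (λ _ → refl) n)) ⟩
    - ((λ j → F (suc (i ℕ.+ j))) ⋆ q) (suc n) ∎

  sgn[n·e]≈-[ι*F] : ∀ n → sgn n (suc n · e v (suc n)) ≈ - (ι (suc n) * F (suc n))
  sgn[n·e]≈-[ι*F] n = begin
    sgn n (suc n · x)            ≈⟨ sgn-cong n (trans (·≈ι* (suc n) x) (*-comm _ _)) ⟩
    sgn n (x * ι (suc n))        ≈⟨ sgn-*ˡ n x _ ⟩
    sgn n x * ι (suc n)          ≈⟨ solve 2 (λ s k → s :* k := :- (k :* (:- s))) refl _ _ ⟩
    - (ι (suc n) * F (suc n))    ∎
    where x = e v (suc n)

  newton : ∀ n → (F ⋆ q) n ≈ - (ι (suc n) * F (suc n))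
  newton zero = trans (*-identityˡ _) (trans (+-identityˡ _) (sgn[n·e]≈-[ι*F] 0))
  newton (suc n) = begin
    1# * (go 1 (ps (suc n)) + L) + ρ    ≈⟨ +-congʳ (*-congˡ (+-congʳ (go-ps 0 n))) ⟩
    1# * (- ρ + L) + ρ                  ≈⟨ solve 2 (λ ρ L → con (+ 1) :* (:- ρ :+ L) :+ ρ := L) refl ρ L ⟩
    L                                   ≈⟨ sgn[n·e]≈-[ι*F] (suc n) ⟩
    - (ι (2 ℕ.+ n) * F (2 ℕ.+ n))       ∎
    where
    ρ = (tail F ⋆ q) n
    L = sgn (suc n) (suc (suc n) · e v (suc (suc n)))

  F-logDeriv : LogDeriv F q
  F-logDeriv n = trans (⋆-comm q F n) (newton n)

  e-beyond-degree : ∀ {n} → d < n → e v n ≡ 0#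
  e-beyond-degree {suc n} d<n with suc n ℕ.≤? d
  ... | yes n≤d = contradiction n≤d (ℕP.<⇒≱ d<n)
  ... | no _ = ≡.refl

module PolynomialCongruences {c ℓ ℓ′ : Level} (A : CommutativeRing c ℓ) (torsionFree : RingDefs.TorsionFree A)
                             {𝔞 : CommutativeRing.Carrier A → Set ℓ′} (𝔞-ideal : RingDefs.IsIdeal A 𝔞)
                             (𝔞-dividedPower : RingDefs.IsDividedPower A 𝔞)
                             {dP dQ : ℕ} (P : Vec (CommutativeRing.Carrier A) dP) (Q : Vec (CommutativeRing.Carrier A) dQ) where
  open CommutativeRing A using (refl; reflexive; trans)
  open RingDefs A
  open IdealProperties A 𝔞-ideal
  module P = PolynomialSeries A P
  module Q = PolynomialSeries A Q
  open DividedPowerIdeal A torsionFree 𝔞-ideal 𝔞-dividedPower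
  open Comparison refl refl P.F-logDeriv Q.F-logDeriv

  ECong : ℕ → Set ℓ′
  ECong n = CongMod 𝔞 (e P n) (e Q n)

  PCong : ℕ → Set (c Level.⊔ ℓ Level.⊔ ℓ′)
  PCong n = CongModMul 𝔞 n (p P n) (p Q n)

  eCong⇒pCong : (∀ n → 1 ≤ n → ECong n) → ∀ n → 1 ≤ n → PCong n
  eCong⇒pCong h (suc m) _ =
    coeffCong⇒logDerivCong (suc m) (λ k _ → congMod-sgn (suc k) (h (suc k) (s≤s z≤n))) m ℕP.≤-refl

  pCong⇒eCong : (∀ n → 1 ≤ n → PCong n) → ∀ n → 1 ≤ n → ECong n
  pCong⇒eCong h (suc m) _ =
    congMod-sgn⁻¹ (suc m) (logDerivCong⇒coeffCong (suc m) (λ k _ → h (suc k) (s≤s z≤n)) m ℕP.≤-refl)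

  pCong≤⇒eCong≤ : (∀ n → 1 ≤ n → n ≤ dP ⊔ dQ → PCong n) → ∀ n → 1 ≤ n → n ≤ dP ⊔ dQ → ECong n
  pCong≤⇒eCong≤ h (suc m) _ m<d =
    congMod-sgn⁻¹ (suc m) (logDerivCong⇒coeffCong (dP ⊔ dQ) (λ k k<d → h (suc k) (s≤s z≤n) k<d) m m<d)

  eCong≤⇒eCong : (∀ n → 1 ≤ n → n ≤ dP ⊔ dQ → ECong n) → ∀ n → 1 ≤ n → ECong n
  eCong≤⇒eCong h n 1≤n with n ℕ.≤? dP ⊔ dQ
  ... | yes n≤d = h n 1≤n n≤d
  ... | no n≰d = congMod-reflexive (trans (reflexive (P.e-beyond-degree (ℕP.≤-<-trans (ℕP.m≤m⊔n dP dQ) d<n)))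
                                          (reflexive (≡.sym (Q.e-beyond-degree (ℕP.≤-<-trans (ℕP.m≤n⊔m dP dQ) d<n)))))
    where d<n = ℕP.≰⇒> n≰d

theorem2p7 : ∀ {c ℓ ℓ' : Level} (prime : ℕ) → Prime prime →
    (A : CommutativeRing c ℓ) →
    RingDefs.TorsionFree A → RingDefs.ZpAlgebra A prime →
    (𝔞 : CommutativeRing.Carrier A → Set ℓ') → RingDefs.IsIdeal A 𝔞 → RingDefs.IsDividedPower A 𝔞 →
    (dP dQ : ℕ) (P : Vec (CommutativeRing.Carrier A) dP) (Q : Vec (CommutativeRing.Carrier A) dQ) →
    let C1 = ∀ (n : ℕ) → 1 ≤ n → RingDefs.CongMod A 𝔞 (RingDefs.e A P n) (RingDefs.e A Q n)
        C2 = ∀ (n : ℕ) → 1 ≤ n → n ≤ dP ⊔ dQ → RingDefs.CongMod A 𝔞 (RingDefs.e A P n) (RingDefs.e A Q n)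
        C3 = ∀ (n : ℕ) → 1 ≤ n → RingDefs.CongModMul A 𝔞 n (RingDefs.p A P n) (RingDefs.p A Q n)
        C4 = ∀ (n : ℕ) → 1 ≤ n → n ≤ dP ⊔ dQ → RingDefs.CongModMul A 𝔞 n (RingDefs.p A P n) (RingDefs.p A Q n)
    in ((C1 → C2) × (C2 → C1)) × ((C1 → C3) × (C3 → C1)) × ((C1 → C4) × (C4 → C1))
theorem2p7 _ _ A torsionFree _ 𝔞 𝔞-ideal 𝔞-dividedPower dP dQ P Q =
    ((λ h n 1≤n _ → h n 1≤n) , eCong≤⇒eCong)
  , (eCong⇒pCong , pCong⇒eCong)
  , ((λ h n 1≤n _ → eCong⇒pCong h n 1≤n) , eCong≤⇒eCong ∘ pCong≤⇒eCong≤)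
  where open PolynomialCongruences A torsionFree 𝔞-ideal 𝔞-dividedPower P Q
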